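{- Suppose $\hat\sigma_0$ has maximum error $\eta$. For every edge $e$ and every $t\in\{0,\dots,m\}$, let $i_t(e)$ be the position of $e$ in $\hat\sigma_t$. Then $|i(e)-i_t(e)|\le\eta$, so $\hat\sigma_t$ also has maximum error at most $\eta$. Consequently, for all $t_1,t_2\in\{0,\dots,m\}$, $|i_{t_1}(e)-i_{t_2}(e)|\le 2\eta$.
   Context: $V$ is a finite vertex set. $\sigma=e_1,\dots,e_m$ is a sequence of $m$ distinct directed edges on $V$. A prediction $\hat\sigma$ is a permutation of $\sigma$. For an edge $e$, $i(e)$ is its position in $\sigma$ and $\hat i(e)$ its position in $\hat\sigma$. The maximum error of $\hat\sigma$ is $\eta=\max_e|i(e)-\hat i(e)|$. Updated predictions are defined as follows. $\hat\sigma_0=\hat\sigma$. For $t=1,\dots,m$, the sequence $\hat\sigma_{t-1}$ agrees with $\sigma$ on its first $t-1$ positions, so $e_t$ sits at a position $\hat t\ge t$ in $\hat\sigma_{t-1}$. The sequence $\hat\sigma_t$ is obtained by removing $e_t$ from position $\hat t$ and reinserting it at position $t$. Edges at positions $t,\dots,\hat t-1$ move one position later; all other edges keep their positions. -}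

module Defs where

open import Data.Nat using (ℕ; zero; suc; _≤_; _<_; ∣_-_∣)
open import Data.Fin using (Fin; toℕ)
open import Data.Product using (_×_; Σ; ∃; ∃-syntax; _,_)
open import Data.Sum using (_⊎_)
open import Relation.Binary.PropositionalEquality using (_≡_)
open import Function.Definitions using (Injective; Bijective)

Edge : ℕ → Set
Edge n = Fin n × Fin n

Seq : ℕ → ℕ → Set
Seq n m = Fin m → Edge n

Distinct : ∀ {n m} → Seq n m → Set
Distinct s = Injective _≡_ _≡_ s

IsPermutationOf : ∀ {n m} → Seq n m → Seq n m → Set
IsPermutationOf {m = m} σ̂ σ =
  ∃[ π ] (Bijective {A = Fin m} _≡_ _≡_ π × (∀ k → σ̂ k ≡ σ (π k)))

ErrorAtMost : ∀ {n m} → Seq n m → Seq n m → ℕ → Set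
ErrorAtMost σ s η = ∀ p q → σ p ≡ s q → ∣ toℕ p - toℕ q ∣ ≤ η

-- η is the maximum error of s w.r.t. σ (η = 0 for the empty sequence)
MaxError : ∀ {n m} → Seq n m → Seq n m → ℕ → Set
MaxError σ s η =
  ErrorAtMost σ s η ×
  (η ≡ 0 ⊎ ∃[ p ] ∃[ q ] (σ p ≡ s q × ∣ toℕ p - toℕ q ∣ ≡ η))

-- s' is obtained from s by removing the entry at (0-based) position j and
-- reinserting it at position t; entries at positions t,…,j-1 move one later,
-- all others stay.
Move : ∀ {n m} → Seq n m → ℕ → Fin m → Seq n m → Set
Move s t j s' =
  (∀ k → (toℕ k < t ⊎ toℕ j < toℕ k) → s' k ≡ s k) ×
  (∀ k → toℕ k ≡ t → s' k ≡ s j) ×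
  (∀ k k' → toℕ k' ≡ suc (toℕ k) → t ≤ toℕ k → toℕ k < toℕ j → s' k' ≡ s k)

-- Updated σ σ̂ t s : s is the updated prediction σ̂_t.
-- (0-based: step from σ̂_t to σ̂_{t+1} moves the edge σ at index t, i.e.
--  the paper's e_{t+1}, found at index j in σ̂_t, to index t.)
data Updated {n m : ℕ} (σ σ̂ : Seq n m) : ℕ → Seq n m → Set where
  upd-zero : Updated σ σ̂ zero σ̂
  upd-suc  : ∀ {t s s'} (t<m : t < m) (j : Fin m) (i : Fin m) →
             toℕ i ≡ t → Updated σ σ̂ t s → s j ≡ σ i → Move s t j s' →
             Updated σ σ̂ (suc t) s'

{-# OPTIONS --safe #-}
-- Invariant along the updates: σ̂_t is a rearrangement of σ that agrees with σ
-- on its first t positions and has maximum error at most η. In the step, the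
-- edge e_{t+1} of σ̂_t lands on its true position, and the edges that move one
-- place later have true positions beyond t, while they end up no later than the
-- old position of e_{t+1}, which is at most t + η. The bound 2η then follows by
-- the triangle inequality through the true position of the edge.
module Submission where

open import Defs
open import Data.Nat using (ℕ; zero; suc; _≤_; _<_; _*_; _+_; ∣_-_∣; z≤n; s≤s; s≤s⁻¹; _<?_; _≟_)
open import Data.Nat.Properties
open import Data.Fin using (Fin; toℕ; inject₁) renaming (zero to fzero; suc to fsuc)
open import Data.Fin.Properties using (toℕ-injective; toℕ-inject₁)
open import Data.Product using (_×_; _,_; proj₁; proj₂; Σ-syntax; ∃-syntax)
open import Data.Sum using (_⊎_; inj₁; inj₂)
open import Data.Empty using (⊥; ⊥-elim)
open import Function using (_∘_)
open import Function.Definitions using (Injective)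
open import Relation.Nullary using (yes; no)
open import Relation.Binary.PropositionalEquality

∣m-n∣≤o⇒m≤n+o : ∀ m n {o} → ∣ m - n ∣ ≤ o → m ≤ n + o
∣m-n∣≤o⇒m≤n+o m n h = ≤-trans (m≤n+∣m-n∣ m n) (+-monoʳ-≤ n h)

∣m-n∣≤o⇒n≤m+o : ∀ m n {o} → ∣ m - n ∣ ≤ o → n ≤ m + o
∣m-n∣≤o⇒n≤m+o m n h = ∣m-n∣≤o⇒m≤n+o n m (subst (_≤ _) (∣-∣-comm m n) h)

m≤n+o∧n≤m+o⇒∣m-n∣≤o : ∀ m n {o} → m ≤ n + o → n ≤ m + o → ∣ m - n ∣ ≤ o
m≤n+o∧n≤m+o⇒∣m-n∣≤o zero    n       _         n≤o       = n≤o
m≤n+o∧n≤m+o⇒∣m-n∣≤o (suc m) zero    m<o       _         = m<o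
m≤n+o∧n≤m+o⇒∣m-n∣≤o (suc m) (suc n) (s≤s m≤n+o) (s≤s n≤m+o) = m≤n+o∧n≤m+o⇒∣m-n∣≤o m n m≤n+o n≤m+o

errorAtMost-triangle : ∀ {n m} {σ s₁ s₂ : Seq n m} {η₁ η₂ p q₁ q₂} →
                      ErrorAtMost σ s₁ η₁ → ErrorAtMost σ s₂ η₂ →
                      σ p ≡ s₁ q₁ → σ p ≡ s₂ q₂ → ∣ toℕ q₁ - toℕ q₂ ∣ ≤ η₁ + η₂
errorAtMost-triangle {p = p} {q₁} {q₂} err₁ err₂ eq₁ eq₂ = begin
  ∣ toℕ q₁ - toℕ q₂ ∣                       ≤⟨ ∣-∣-triangle (toℕ q₁) (toℕ p) (toℕ q₂) ⟩
  ∣ toℕ q₁ - toℕ p ∣ + ∣ toℕ p - toℕ q₂ ∣   ≡⟨ cong (_+ _) (∣-∣-comm (toℕ q₁) (toℕ p)) ⟩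
  ∣ toℕ p - toℕ q₁ ∣ + ∣ toℕ p - toℕ q₂ ∣   ≤⟨ +-mono-≤ (err₁ p q₁ eq₁) (err₂ p q₂ eq₂) ⟩
  _                                         ∎
  where open ≤-Reasoning

predecessor : ∀ {m} (k : Fin m) → 0 < toℕ k → Σ[ y ∈ Fin m ] toℕ k ≡ suc (toℕ y)
predecessor {suc m} fzero ()
predecessor {suc m} (fsuc y) _ = inject₁ y , cong suc (sym (toℕ-inject₁ y))

module _ {m : ℕ} where

  -- MoveView t j k y: after moving position j to position t, position k holds
  -- what position y held before.
  data MoveView (t : ℕ) (j : Fin m) : Fin m → Fin m → Set where
    fixed    : ∀ {k} → toℕ k < t ⊎ toℕ j < toℕ k → MoveView t j k k
    inserted : ∀ {k} → toℕ k ≡ t → MoveView t j k j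
    shifted  : ∀ {k y} → t ≤ toℕ y → toℕ y < toℕ j → toℕ k ≡ suc (toℕ y) → MoveView t j k y

  moveView : ∀ t (j k : Fin m) → ∃[ y ] MoveView t j k y
  moveView t j k with toℕ k <? t | toℕ j <? toℕ k | toℕ k ≟ t
  ... | yes k<t | _       | _       = k , fixed (inj₁ k<t)
  ... | no _    | yes j<k | _       = k , fixed (inj₂ j<k)
  ... | no _    | no _    | yes k≡t = j , inserted k≡t
  ... | no k≮t  | no j≮k  | no k≢t  =
    let t<k = ≤∧≢⇒< (≮⇒≥ k≮t) (k≢t ∘ sym)
        y , k≡1+y = predecessor k (≤-<-trans z≤n t<k)
    in  y , shifted (s≤s⁻¹ (subst (t <_) k≡1+y t<k)) (subst (_≤ toℕ j) k≡1+y (≮⇒≥ j≮k)) k≡1+y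

  moveSource : ℕ → Fin m → Fin m → Fin m
  moveSource t j k = proj₁ (moveView t j k)

  private
    fixed-at-j : ∀ {t} {j : Fin m} → t ≤ toℕ j → toℕ j < t ⊎ toℕ j < toℕ j → ⊥
    fixed-at-j t≤j (inj₁ j<t) = <⇒≱ j<t t≤j
    fixed-at-j _   (inj₂ j<j) = <-irrefl refl j<j

    fixed-and-shifted : ∀ {t} {j y : Fin m} →
                        toℕ y < t ⊎ toℕ j < toℕ y → t ≤ toℕ y → toℕ y < toℕ j → ⊥
    fixed-and-shifted (inj₁ y<t) t≤y _   = <⇒≱ y<t t≤y
    fixed-and-shifted (inj₂ j<y) _   y<j = <-asym j<y y<j

  moveView-injective : ∀ {t j a b y} → t ≤ toℕ j →
                       MoveView t j a y → MoveView t j b y → a ≡ b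
  moveView-injective _   (fixed _)             (fixed _)             = refl
  moveView-injective t≤j (fixed j∉[t,j])       (inserted _)          = ⊥-elim (fixed-at-j t≤j j∉[t,j])
  moveView-injective t≤j (inserted _)          (fixed j∉[t,j])       = ⊥-elim (fixed-at-j t≤j j∉[t,j])
  moveView-injective _   (fixed y∉[t,j])       (shifted t≤y y<j _)   = ⊥-elim (fixed-and-shifted y∉[t,j] t≤y y<j)
  moveView-injective _   (shifted t≤y y<j _)   (fixed y∉[t,j])       = ⊥-elim (fixed-and-shifted y∉[t,j] t≤y y<j)
  moveView-injective _   (inserted a≡t)        (inserted b≡t)        = toℕ-injective (trans a≡t (sym b≡t))
  moveView-injective _   (inserted _)          (shifted _ j<j _)     = ⊥-elim (<-irrefl refl j<j)
  moveView-injective _   (shifted _ j<j _)     (inserted _)          = ⊥-elim (<-irrefl refl j<j)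
  moveView-injective _   (shifted _ _ a≡1+y)   (shifted _ _ b≡1+y)   = toℕ-injective (trans a≡1+y (sym b≡1+y))

  moveSource-injective : ∀ {t j} → t ≤ toℕ j → Injective _≡_ _≡_ (moveSource t j)
  moveSource-injective {t} {j} t≤j {a} {b} eq =
    moveView-injective t≤j (proj₂ (moveView t j a))
                           (subst (MoveView t j b) (sym eq) (proj₂ (moveView t j b)))

  Move⇒≡-moveView : ∀ {n t j k y} {s s' : Seq n m} → Move s t j s' → MoveView t j k y → s' k ≡ s y
  Move⇒≡-moveView (keep , _ , _) (fixed k∉[t,j])           = keep _ k∉[t,j]
  Move⇒≡-moveView (_ , put , _)  (inserted k≡t)            = put _ k≡t
  Move⇒≡-moveView (_ , _ , shift) (shifted t≤y y<j k≡1+y) = shift _ _ k≡1+y t≤y y<j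

  Move⇒≡-moveSource : ∀ {n t j} {s s' : Seq n m} → Move s t j s' → ∀ k → s' k ≡ s (moveSource t j k)
  Move⇒≡-moveSource {t = t} {j} mv k = Move⇒≡-moveView mv (proj₂ (moveView t j k))

module Invariant-along-updates {n m : ℕ} (σ : Seq n m) (η : ℕ) (σ-distinct : Distinct σ) where

  record Invariant (t : ℕ) (s : Seq n m) : Set where
    field
      source          : Fin m → Fin m
      source-injective : Injective _≡_ _≡_ source
      s≡σ∘source      : ∀ k → s k ≡ σ (source k)
      prefix          : ∀ k → toℕ k < t → s k ≡ σ k
      error           : ErrorAtMost σ s η

    injective : Injective _≡_ _≡_ s
    injective {a} {b} sa≡sb =
      source-injective (σ-distinct (trans (sym (s≡σ∘source a)) (trans sa≡sb (s≡σ∘source b))))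

  module Step {t} {s s' : Seq n m} {i j : Fin m} (I : Invariant t s)
              (i≡t : toℕ i ≡ t) (sj≡σi : s j ≡ σ i) (mv : Move s t j s') where
    open Invariant I

    t≤j : t ≤ toℕ j
    t≤j with toℕ j <? t
    ... | no  j≮t = ≮⇒≥ j≮t
    ... | yes j<t = ⊥-elim (<-irrefl j≡t j<t)
      where
        j≡t : toℕ j ≡ t
        j≡t = trans (cong toℕ (σ-distinct (trans (sym (prefix j j<t)) sj≡σi))) i≡t

    j≤t+η : toℕ j ≤ t + η
    j≤t+η = subst (λ x → toℕ j ≤ x + η) i≡t (∣m-n∣≤o⇒n≤m+o (toℕ i) (toℕ j) (error i j (sym sj≡σi)))

    -- Positions below t already hold their own edges, and σ t sits at j.
    t<true-position : ∀ {p y} → σ p ≡ s y → t ≤ toℕ y → y ≢ j → t < toℕ p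
    t<true-position {p} {y} σp≡sy t≤y y≢j with toℕ p <? t | toℕ p ≟ t
    ... | yes p<t | _       = ⊥-elim (<⇒≱ (subst (λ x → toℕ x < t) p≡y p<t) t≤y)
      where
        p≡y : p ≡ y
        p≡y = injective (trans (prefix p p<t) σp≡sy)
    ... | no _    | yes p≡t = ⊥-elim (y≢j (injective (trans (sym σp≡sy) σp≡sj)))
      where
        σp≡sj : σ p ≡ s j
        σp≡sj = trans (cong σ (toℕ-injective (trans p≡t (sym i≡t)))) (sym sj≡σi)
    ... | no p≮t  | no p≢t  = ≤∧≢⇒< (≮⇒≥ p≮t) (p≢t ∘ sym)

    shifted-error : ∀ {p y} → σ p ≡ s y → t ≤ toℕ y → toℕ y < toℕ j → ∣ toℕ p - suc (toℕ y) ∣ ≤ η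
    shifted-error {p} {y} σp≡sy t≤y y<j = m≤n+o∧n≤m+o⇒∣m-n∣≤o (toℕ p) (suc (toℕ y))
      (m≤n⇒m≤1+n (∣m-n∣≤o⇒m≤n+o (toℕ p) (toℕ y) (error p y σp≡sy)))
      (begin
        suc (toℕ y)  ≤⟨ y<j ⟩
        toℕ j        ≤⟨ j≤t+η ⟩
        t + η        ≤⟨ +-monoˡ-≤ η (<⇒≤ t<p) ⟩
        toℕ p + η    ∎)
      where
        open ≤-Reasoning
        t<p : t < toℕ p
        t<p = t<true-position σp≡sy t≤y (λ y≡j → <-irrefl (cong toℕ y≡j) y<j)

    error' : ErrorAtMost σ s' η
    error' p q σp≡s'q with moveView t j q
    ... | y , view with trans σp≡s'q (Move⇒≡-moveView mv view) | view
    ... | σp≡sy | fixed _ = error p q σp≡sy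
    ... | σp≡sj | inserted q≡t = subst (_≤ η) (sym (m≡n⇒∣m-n∣≡0 p≡q)) z≤n
      where
        p≡q : toℕ p ≡ toℕ q
        p≡q = trans (cong toℕ (σ-distinct (trans σp≡sj sj≡σi))) (trans i≡t (sym q≡t))
    ... | σp≡sy | shifted t≤y y<j q≡1+y =
      subst (λ x → ∣ toℕ p - x ∣ ≤ η) (sym q≡1+y) (shifted-error σp≡sy t≤y y<j)

    prefix' : ∀ k → toℕ k < suc t → s' k ≡ σ k
    prefix' k k<1+t with toℕ k <? t
    ... | yes k<t = trans (Move⇒≡-moveView mv (fixed (inj₁ k<t))) (prefix k k<t)
    ... | no  k≮t = trans (Move⇒≡-moveView mv (inserted k≡t)) (trans sj≡σi (cong σ (toℕ-injective (trans i≡t (sym k≡t)))))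
      where
        k≡t : toℕ k ≡ t
        k≡t = ≤-antisym (s≤s⁻¹ k<1+t) (≮⇒≥ k≮t)

    invariant' : Invariant (suc t) s'
    invariant' = record
      { source           = source ∘ moveSource t j
      ; source-injective = moveSource-injective t≤j ∘ source-injective
      ; s≡σ∘source       = λ k → trans (Move⇒≡-moveSource mv k) (s≡σ∘source (moveSource t j k))
      ; prefix           = prefix'
      ; error            = error'
      }

  Updated⇒Invariant : ∀ {σ̂ t s} → Invariant 0 σ̂ → Updated σ σ̂ t s → Invariant t s
  Updated⇒Invariant I₀ upd-zero = I₀
  Updated⇒Invariant I₀ (upd-suc _ j i i≡t u sj≡σi mv) = Step.invariant' (Updated⇒Invariant I₀ u) i≡t sj≡σi mv

  displacement≤2*η : ∀ {t₁ t₂ s₁ s₂ q₁ q₂} → Invariant t₁ s₁ → Invariant t₂ s₂ →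
                     s₁ q₁ ≡ s₂ q₂ → ∣ toℕ q₁ - toℕ q₂ ∣ ≤ 2 * η
  displacement≤2*η {s₁ = s₁} {q₁ = q₁} {q₂} I₁ I₂ s₁q₁≡s₂q₂ =
    subst (∣ toℕ q₁ - toℕ q₂ ∣ ≤_) (cong (η +_) (sym (+-identityʳ η)))
      (errorAtMost-triangle (Invariant.error I₁) (Invariant.error I₂) σp≡s₁q₁ (trans σp≡s₁q₁ s₁q₁≡s₂q₂))
    where
      σp≡s₁q₁ : σ (Invariant.source I₁ q₁) ≡ s₁ q₁
      σp≡s₁q₁ = sym (Invariant.s≡σ∘source I₁ q₁)

lemma4 : ∀ {n m : ℕ} (σ σ̂ : Seq n m) (η : ℕ) →
         Distinct σ → IsPermutationOf σ̂ σ → MaxError σ σ̂ η →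
         (∀ t s → t ≤ m → Updated σ σ̂ t s → ErrorAtMost σ s η) ×
         (∀ t₁ t₂ s₁ s₂ → t₁ ≤ m → t₂ ≤ m →
            Updated σ σ̂ t₁ s₁ → Updated σ σ̂ t₂ s₂ →
            ∀ (e : Edge n) (q₁ q₂ : Fin m) → s₁ q₁ ≡ e → s₂ q₂ ≡ e →
            ∣ toℕ q₁ - toℕ q₂ ∣ ≤ 2 * η)
lemma4 σ σ̂ η σ-distinct (π , (π-injective , _) , σ̂≡σ∘π) (σ̂-error , _) =
    (λ _ _ _ u → Invariant.error (invariant u))
  , λ _ _ _ _ _ _ u₁ u₂ _ _ _ s₁q₁≡e s₂q₂≡e →
      displacement≤2*η (invariant u₁) (invariant u₂) (trans s₁q₁≡e (sym s₂q₂≡e))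
  where
    open Invariant-along-updates σ η σ-distinct

    invariant : ∀ {t s} → Updated σ σ̂ t s → Invariant t s
    invariant = Updated⇒Invariant record
      { source = π ; source-injective = π-injective ; s≡σ∘source = σ̂≡σ∘π
      ; prefix = λ _ () ; error = σ̂-error }
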